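{- Let $p$ be a positive integer and $n\ge 1$. Let $a_p(n)$, $s_p(n)$ and $i_p(n)$ denote, respectively, the sum of $\mathrm{area}(P)$, the sum of $\mathrm{sper}(P)$, and the sum of $\mathrm{inn}(P)$ over all $p$-Fibonacci polyominoes $P$ with $n$ columns. Then \[F_{p,n+1}=i_p(n)+s_p(n)-a_p(n).\]
   Context: The $p$-generalized Fibonacci numbers $F_{p,n}$ are defined by $F_{p,n}=0$ for $n=-p+2,\dots,0$, $F_{p,1}=1$, and $F_{p,n}=\sum_{i=1}^{p}F_{p,n-i}$ for $n>1$. A $p$-Fibonacci word of length $n\ge 1$ is a word $u=u_1u_2\cdots u_n$ over $\{1,\dots,p\}$ with $u_1=p$ and, for $1\le i\le n-1$: if $u_i=1$ then $u_{i+1}=p$; if $2\le u_i\le p$ then $u_{i+1}\in\{u_i-1,\,p\}$. Each such word determines a polyomino (bargraph) with $n$ columns: $n$ adjacent columns of unit square cells resting on a common horizontal base line, the $i$-th column having $u_i$ cells; these are the $p$-Fibonacci polyominoes. For such $P$: $\mathrm{area}(P)$ is the number of cells, $\mathrm{sper}(P)$ is half the length of the perimeter of $P$, and $\mathrm{inn}(P)$ is the number of lattice points not on the boundary of $P$ (equivalently, lattice points that are corners of exactly four cells of $P$). -}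

module Defs where

open import Data.Nat using (ℕ; zero; suc; _+_; _∸_; _≤ᵇ_; _≡ᵇ_; _⊔_; ⌊_/2⌋)
open import Data.Bool using (Bool; true; false; _∧_; _∨_; not; if_then_else_)
open import Data.Nat.ListAction using (sum)
open import Data.List using (List; []; _∷_; map; concatMap; applyUpTo; take; replicate; length; upTo; foldr)

-- p-generalized Fibonacci numbers.
-- window p k = [F_{p,k+1}, F_{p,k}, ..., F_{p,k-p+2}]  (p entries)
window : ℕ → ℕ → List ℕ
window p zero    = 1 ∷ replicate (p ∸ 1) 0
window p (suc k) = sum (window p k) ∷ take (p ∸ 1) (window p k)

head0 : List ℕ → ℕ
head0 []      = 0
head0 (x ∷ _) = x

-- F p n = F_{p,n} for n ≥ 1 (F p 0 = 0 = F_{p,0}).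
F : ℕ → ℕ → ℕ
F p zero    = 0
F p (suc k) = head0 (window p k)

stepOK : ℕ → ℕ → ℕ → Bool
stepOK p a b = if a ≡ᵇ 1 then b ≡ᵇ p else ((b ≡ᵇ (a ∸ 1)) ∨ (b ≡ᵇ p))

chainOK : ℕ → List ℕ → Bool
chainOK p []            = true
chainOK p (a ∷ [])      = true
chainOK p (a ∷ b ∷ w)   = stepOK p a b ∧ chainOK p (b ∷ w)

inAlphabet : ℕ → ℕ → Bool
inAlphabet p a = (1 ≤ᵇ a) ∧ (a ≤ᵇ p)

allIn : ℕ → List ℕ → Bool
allIn p []      = true
allIn p (a ∷ w) = inAlphabet p a ∧ allIn p w

isPFibWord : ℕ → List ℕ → Bool
isPFibWord p []      = false
isPFibWord p (a ∷ w) = (a ≡ᵇ p) ∧ allIn p (a ∷ w) ∧ chainOK p (a ∷ w)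

allWords : ℕ → ℕ → List (List ℕ)
allWords p zero    = [] ∷ []
allWords p (suc n) = concatMap (λ w → map (_∷ w) (applyUpTo suc p)) (allWords p n)

-- The bargraph polyomino of a word u.
-- Cell (i , j) (i, j ≥ 1) is the unit square [i-1,i] × [j-1,j];
-- it belongs to P(u) iff 1 ≤ i ≤ n and 1 ≤ j ≤ u_i.

col : List ℕ → ℕ → ℕ
col []      _             = 0
col (a ∷ w) zero          = 0
col (a ∷ w) (suc zero)    = a
col (a ∷ w) (suc (suc i)) = col w (suc i)

inP : List ℕ → ℕ → ℕ → Bool
inP u i j = (1 ≤ᵇ j) ∧ (j ≤ᵇ col u i)

ind : Bool → ℕ
ind true  = 1
ind false = 0

xor : Bool → Bool → Bool
xor a b = if a then not b else b

Σ≤ : ℕ → (ℕ → ℕ) → ℕ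
Σ≤ m f = sum (map f (upTo (suc m)))

height : List ℕ → ℕ
height u = foldr _⊔_ 0 u

area : List ℕ → ℕ
area u = Σ≤ (suc (length u)) λ i → Σ≤ (suc (height u)) λ j → ind (inP u i j)

-- length of the boundary: number of unit lattice edges having exactly
-- one of their two adjacent cells in P
perimeter : List ℕ → ℕ
perimeter u =
    (Σ≤ (length u) λ x → Σ≤ (suc (height u)) λ j → ind (xor (inP u x j) (inP u (suc x) j)))
  + (Σ≤ (suc (length u)) λ i → Σ≤ (height u) λ y → ind (xor (inP u i y) (inP u i (suc y))))

sper : List ℕ → ℕ
sper u = ⌊ perimeter u /2⌋

-- number of lattice points (x , y) that are corners of exactly four cells of P,
-- namely of the cells (x,y), (x+1,y), (x,y+1), (x+1,y+1)
inn : List ℕ → ℕ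
inn u = Σ≤ (length u) λ x → Σ≤ (height u) λ y →
  ind (inP u x y ∧ inP u (suc x) y ∧ inP u x (suc y) ∧ inP u (suc x) (suc y))

sumOverPFib : (List ℕ → ℕ) → ℕ → ℕ → ℕ
sumOverPFib f p n = sum (map (λ w → if isPFibWord p w then f w else 0) (allWords p n))

a : ℕ → ℕ → ℕ
a = sumOverPFib area

s : ℕ → ℕ → ℕ
s = sumOverPFib sper

i : ℕ → ℕ → ℕ
i = sumOverPFib inn

{-# OPTIONS --safe #-}
module Submission where

-- Two independent facts combine, word by word.
--
-- Geometry: in a bargraph whose n columns have positive heights u₁ … uₙ,
-- the perimeter is 2n + u₁ + uₙ + Σ |uᵢ − uᵢ₊₁| and the interior points are
-- Σ (min(uᵢ, uᵢ₊₁) − 1), the sums over adjacent columns.  Since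
-- |c − d| + 2 min(c, d) = c + d, this gives perimeter + 2 inn = 2 (area + 1),
-- i.e. 1 + area = inn + sper for every such polyomino.
--
-- Counting: a p-Fibonacci word of length n + 1 is p followed by a word w
-- that may follow the letter p.  If Cₙ(c) counts the words of length n that
-- may follow the letter c, then Cₙ₊₁(1) = Cₙ(p) and Cₙ₊₁(c) = Cₙ(c − 1) + Cₙ(p)
-- for c ≥ 2, so Cₙ(c) is the sum of the first c entries of the window
-- F_{p,n+1}, F_{p,n}, … , F_{p,n−p+2}; in particular Cₙ(p) = F_{p,n+2}.

open import Defs
open import Algebra.Bundles using (CommutativeMonoid)
open import Data.Bool using (Bool; true; false; T; _∧_; _∨_; if_then_else_)
open import Data.Bool.Properties using (∧-commutativeMonoid; ∧-zeroʳ; T-∧; T-≡)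
open import Data.List using (List; []; _∷_; map; applyUpTo; upTo; length; concatMap; take; replicate; _++_)
open import Data.List.Properties
  using (map-cong; map-id; map-++; map-applyUpTo; take-all; take-take; length-take; length-replicate)
open import Data.List.Relation.Unary.All using (All; []; _∷_)
open import Data.Nat
  using (ℕ; zero; suc; _+_; _*_; _∸_; _≤_; _<_; z≤n; s≤s; _≤ᵇ_; _<ᵇ_; _≡ᵇ_; _⊓_; ∣_-_∣; ⌊_/2⌋)
open import Data.Nat.ListAction using (sum)
open import Data.Nat.ListAction.Properties using (sum-++)
open import Data.Nat.Properties
  using (+-identityʳ; +-assoc; +-suc; +-comm; +-commutativeSemigroup; ≤-refl; ≤-reflexive; ≤-trans;
         m≤m⊔n; m≤n⊔m; m≤n⇒m≤1+n; m≤n⇒m⊓n≡m; n≤1+n; <⇒≤; <⇒<ᵇ)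
open import Data.Nat.Tactic.RingSolver using (solve-∀)
open import Data.Product using (_×_; proj₁; proj₂)
open import Function.Bundles using (Equivalence)
open import Relation.Binary.PropositionalEquality
  using (_≡_; refl; sym; trans; cong; cong₂; module ≡-Reasoning)
open import Algebra.Properties.CommutativeSemigroup +-commutativeSemigroup
  using () renaming (interchange to +-interchange)
open import Algebra.Properties.CommutativeSemigroup
  (CommutativeMonoid.commutativeSemigroup ∧-commutativeMonoid)
  using () renaming (x∙yz≈y∙xz to ∧-leftComm)

open ≡-Reasoning

Σ< : ℕ → (ℕ → ℕ) → ℕ
Σ< zero    f = 0
Σ< (suc m) f = f 0 + Σ< m (λ k → f (suc k))

Σ<-cong : ∀ m {f g : ℕ → ℕ} → (∀ {k} → k < m → f k ≡ g k) → Σ< m f ≡ Σ< m g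
Σ<-cong zero    f≡g = refl
Σ<-cong (suc m) f≡g = cong₂ _+_ (f≡g (s≤s z≤n)) (Σ<-cong m (λ k<m → f≡g (s≤s k<m)))

Σ<-zero : ∀ m → Σ< m (λ _ → 0) ≡ 0
Σ<-zero zero    = refl
Σ<-zero (suc m) = Σ<-zero m

Σ<-+ : ∀ m (f g : ℕ → ℕ) → Σ< m (λ k → f k + g k) ≡ Σ< m f + Σ< m g
Σ<-+ zero    f g = refl
Σ<-+ (suc m) f g = trans (cong (f 0 + g 0 +_) (Σ<-+ m (λ k → f (suc k)) (λ k → g (suc k))))
                         (+-interchange (f 0) (g 0) _ _)

Σ<-indicator : ∀ {t m} (P : ℕ → Bool) → t < m → Σ< m (λ k → ind ((k ≡ᵇ t) ∧ P k)) ≡ ind (P t)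
Σ<-indicator {zero}  {suc m} P _         = trans (cong (ind (P 0) +_) (Σ<-zero m)) (+-identityʳ _)
Σ<-indicator {suc t} {suc m} P (s≤s t<m) = Σ<-indicator (λ k → P (suc k)) t<m

sum-map-applyUpTo : ∀ {A : Set} (f : A → ℕ) (g : ℕ → A) m → sum (map f (applyUpTo g m)) ≡ Σ< m (λ k → f (g k))
sum-map-applyUpTo f g zero    = refl
sum-map-applyUpTo f g (suc m) = cong (f (g 0) +_) (sum-map-applyUpTo f (λ k → g (suc k)) m)

Σ≤≡Σ< : ∀ m f → Σ≤ m f ≡ Σ< (suc m) f
Σ≤≡Σ< m f = sum-map-applyUpTo f (λ k → k) (suc m)

Σ≤-cong : ∀ m {f g : ℕ → ℕ} → (∀ k → f k ≡ g k) → Σ≤ m f ≡ Σ≤ m g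
Σ≤-cong m f≡g = cong sum (map-cong f≡g (upTo (suc m)))

sum-map-+ : ∀ {A : Set} (f g : A → ℕ) xs → sum (map (λ x → f x + g x) xs) ≡ sum (map f xs) + sum (map g xs)
sum-map-+ f g []       = refl
sum-map-+ f g (x ∷ xs) = trans (cong (f x + g x +_) (sum-map-+ f g xs)) (+-interchange (f x) (g x) _ _)

sum-map-concatMap : ∀ {A B : Set} (f : B → ℕ) (g : A → List B) xs →
  sum (map f (concatMap g xs)) ≡ sum (map (λ x → sum (map f (g x))) xs)
sum-map-concatMap f g []       = refl
sum-map-concatMap f g (x ∷ xs) = begin
    sum (map f (g x ++ concatMap g xs))
  ≡⟨ cong sum (map-++ f (g x) (concatMap g xs)) ⟩
    sum (map f (g x) ++ map f (concatMap g xs))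
  ≡⟨ sum-++ (map f (g x)) _ ⟩
    sum (map f (g x)) + sum (map f (concatMap g xs))
  ≡⟨ cong (sum (map f (g x)) +_) (sum-map-concatMap f g xs) ⟩
    sum (map f (g x)) + sum (map (λ y → sum (map f (g y))) xs) ∎

cell : ℕ → ℕ → Bool
cell c j = (1 ≤ᵇ j) ∧ (j ≤ᵇ c)

horizontalEdges : ℕ → ℕ
horizontalEdges zero    = 0
horizontalEdges (suc _) = 2

innerPoints : ℕ → ℕ → ℕ
innerPoints c d = c ⊓ d ∸ 1

-- In the Σ< lemmas, row j counts from 0: it is occupied in a column of height c
-- iff j <ᵇ c, which is cell c (suc j).

column-height : ∀ {c M} → c ≤ M → Σ< M (λ j → ind (j <ᵇ c)) ≡ c
column-height {zero}  {M}     _         = Σ<-zero M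
column-height {suc c} {suc M} (s≤s c≤M) = cong suc (column-height c≤M)

column-verticalEdges : ∀ {c d M} → c ≤ M → d ≤ M → Σ< M (λ j → ind (xor (j <ᵇ c) (j <ᵇ d))) ≡ ∣ c - d ∣
column-verticalEdges {zero}  {d}     {M}     _         d≤M       = column-height d≤M
column-verticalEdges {suc c} {zero}  {M}     c≤M       _         =
  trans (Σ<-cong M (λ {j} _ → cong ind (xor-false (j <ᵇ suc c)))) (column-height c≤M)
  where
  xor-false : ∀ x → xor x false ≡ x
  xor-false true  = refl
  xor-false false = refl
column-verticalEdges {suc c} {suc d} {suc M} (s≤s c≤M) (s≤s d≤M) = column-verticalEdges c≤M d≤M

column-top : ∀ {c M} → c < M → Σ< M (λ j → ind (xor (j <ᵇ suc c) (j <ᵇ c))) ≡ 1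
column-top {zero}  {suc M} _         = cong suc (Σ<-zero M)
column-top {suc c} {suc M} (s≤s c<M) = column-top c<M

column-horizontalEdges : ∀ {c M} → c ≤ M →
  Σ≤ M (λ j → ind (xor (cell c j) (cell c (suc j)))) ≡ horizontalEdges c
column-horizontalEdges {zero}  {M} _   =
  trans (Σ≤≡Σ< M (λ j → ind (xor (cell 0 j) (cell 0 (suc j))))) (Σ<-zero M)
column-horizontalEdges {suc c} {M} c<M =
  trans (Σ≤≡Σ< M (λ j → ind (xor (cell (suc c) j) (cell (suc c) (suc j))))) (cong suc (column-top c<M))

column-innerPoints : ∀ {c d M} → c ≤ M → d ≤ M →
  Σ< M (λ j → ind ((j <ᵇ c) ∧ (j <ᵇ d) ∧ (suc j <ᵇ c) ∧ (suc j <ᵇ d))) ≡ innerPoints c d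
column-innerPoints {zero}        {d}           {M}     _         _         = Σ<-zero M
column-innerPoints {suc c}       {zero}        {M}     _         _         =
  trans (Σ<-cong M (λ {j} _ → cong ind (∧-zeroʳ (j <ᵇ suc c)))) (Σ<-zero M)
column-innerPoints {suc zero}    {suc d}       {suc M} (s≤s c≤M) (s≤s d≤M) = column-innerPoints {zero} c≤M d≤M
column-innerPoints {suc (suc c)} {suc zero}    {suc M} (s≤s c≤M) (s≤s d≤M) = column-innerPoints {suc c} {zero} c≤M d≤M
column-innerPoints {suc (suc c)} {suc (suc d)} {suc M} (s≤s c≤M) (s≤s d≤M) = cong suc (column-innerPoints c≤M d≤M)

-- The last column is paired with an empty column (col [] 1 = 0).
adjacentSum : (ℕ → ℕ → ℕ) → List ℕ → ℕ
adjacentSum h []      = 0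
adjacentSum h (c ∷ u) = h c (col u 1) + adjacentSum h u

col-zero : ∀ u → col u 0 ≡ 0
col-zero []      = refl
col-zero (_ ∷ _) = refl

col≤height : ∀ u i → col u i ≤ height u
col≤height []      i             = z≤n
col≤height (c ∷ u) zero          = z≤n
col≤height (c ∷ u) (suc zero)    = m≤m⊔n c (height u)
col≤height (c ∷ u) (suc (suc i)) = ≤-trans (col≤height u (suc i)) (m≤n⊔m c (height u))

Σ<-columns : ∀ u (g : ℕ → ℕ) → Σ< (suc (length u)) (λ i → g (col u (suc i))) ≡ sum (map g u) + g 0
Σ<-columns []      g = +-identityʳ (g 0)
Σ<-columns (c ∷ u) g = trans (cong (g c +_) (Σ<-columns u g)) (sym (+-assoc (g c) _ _))

Σ≤-columns : ∀ u (g : ℕ → ℕ) → g 0 ≡ 0 → Σ≤ (suc (length u)) (λ i → g (col u i)) ≡ sum (map g u)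
Σ≤-columns u g g0≡0 = begin
    Σ≤ (suc (length u)) (λ i → g (col u i))
  ≡⟨ Σ≤≡Σ< (suc (length u)) (λ i → g (col u i)) ⟩
    g (col u 0) + Σ< (suc (length u)) (λ i → g (col u (suc i)))
  ≡⟨ cong₂ _+_ (trans (cong g (col-zero u)) g0≡0) (Σ<-columns u g) ⟩
    sum (map g u) + g 0
  ≡⟨ trans (cong (sum (map g u) +_) g0≡0) (+-identityʳ _) ⟩
    sum (map g u) ∎

Σ<-adjacent : ∀ u (h : ℕ → ℕ → ℕ) →
  Σ< (length u) (λ i → h (col u (suc i)) (col u (suc (suc i)))) ≡ adjacentSum h u
Σ<-adjacent []      h = refl
Σ<-adjacent (c ∷ u) h = cong (h c (col u 1) +_) (Σ<-adjacent u h)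

Σ≤-adjacent : ∀ u (h : ℕ → ℕ → ℕ) →
  Σ≤ (length u) (λ i → h (col u i) (col u (suc i))) ≡ h 0 (col u 1) + adjacentSum h u
Σ≤-adjacent u h = trans (Σ≤≡Σ< (length u) (λ i → h (col u i) (col u (suc i))))
  (cong₂ _+_ (cong (λ c → h c (col u 1)) (col-zero u)) (Σ<-adjacent u h))

area≡sum : ∀ u → area u ≡ sum u
area≡sum u = begin
    area u
  ≡⟨ Σ≤-cong (suc (length u)) (λ i → trans (Σ≤≡Σ< (suc (height u)) (λ j → ind (inP u i j)))
                                            (column-height (m≤n⇒m≤1+n (col≤height u i)))) ⟩
    Σ≤ (suc (length u)) (λ i → col u i)
  ≡⟨ Σ≤-columns u (λ c → c) refl ⟩
    sum (map (λ c → c) u)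
  ≡⟨ cong sum (map-id u) ⟩
    sum u ∎

perimeter≡columnSums : ∀ u → perimeter u ≡ (col u 1 + adjacentSum ∣_-_∣ u) + sum (map horizontalEdges u)
perimeter≡columnSums u = cong₂ _+_
  (trans (Σ≤-cong (length u) (λ i → trans (Σ≤≡Σ< (suc (height u)) (λ j → ind (xor (inP u i j) (inP u (suc i) j))))
                                            (column-verticalEdges (bound i) (bound (suc i)))))
         (Σ≤-adjacent u ∣_-_∣))
  (trans (Σ≤-cong (suc (length u)) (λ i → column-horizontalEdges (col≤height u i)))
         (Σ≤-columns u horizontalEdges refl))
  where
  bound : ∀ i → col u i ≤ suc (height u)
  bound i = m≤n⇒m≤1+n (col≤height u i)

inn≡adjacentSum : ∀ u → inn u ≡ adjacentSum innerPoints u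
inn≡adjacentSum u =
  trans (Σ≤-cong (length u) (λ i → trans (Σ≤≡Σ< (height u) (λ j → ind (occupied i j)))
                                          (column-innerPoints (col≤height u i) (col≤height u (suc i)))))
        (Σ≤-adjacent u innerPoints)
  where
  occupied : ℕ → ℕ → Bool
  occupied i j = inP u i j ∧ inP u (suc i) j ∧ inP u i (suc j) ∧ inP u (suc i) (suc j)

∣m-n∣+2*[m⊓n]≡m+n : ∀ m n → ∣ m - n ∣ + 2 * (m ⊓ n) ≡ m + n
∣m-n∣+2*[m⊓n]≡m+n zero    n       = +-identityʳ n
∣m-n∣+2*[m⊓n]≡m+n (suc m) zero    = refl
∣m-n∣+2*[m⊓n]≡m+n (suc m) (suc n) = begin
    ∣ m - n ∣ + 2 * suc (m ⊓ n)
  ≡⟨ shift ∣ m - n ∣ (m ⊓ n) ⟩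
    suc (suc (∣ m - n ∣ + 2 * (m ⊓ n)))
  ≡⟨ cong (λ x → suc (suc x)) (∣m-n∣+2*[m⊓n]≡m+n m n) ⟩
    suc (suc (m + n))
  ≡⟨ cong suc (sym (+-suc m n)) ⟩
    suc m + suc n ∎
  where
  shift : ∀ d k → d + 2 * suc k ≡ suc (suc (d + 2 * k))
  shift = solve-∀

boundary+2*inner : ∀ c u → All (1 ≤_) (c ∷ u) →
  adjacentSum ∣_-_∣ (c ∷ u) + sum (map horizontalEdges (c ∷ u)) + 2 * adjacentSum innerPoints (c ∷ u)
    ≡ c + 2 + 2 * sum u
boundary+2*inner zero    u           (() ∷ _)
boundary+2*inner (suc c) (zero ∷ u)  (_ ∷ () ∷ _)
boundary+2*inner (suc c) []          _ = single c
  where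
  single : ∀ c → suc c + 0 + (2 + 0) + 2 * (0 + 0) ≡ suc c + 2 + 2 * 0
  single = solve-∀
boundary+2*inner (suc c) (suc d ∷ u) (_ ∷ positive) = begin
    (∣ c - d ∣ + V) + (2 + H) + 2 * (c ⊓ d + I)
  ≡⟨ regroup ∣ c - d ∣ V H (c ⊓ d) I ⟩
    (∣ c - d ∣ + 2 * (c ⊓ d)) + 2 + (V + H + 2 * I)
  ≡⟨ cong₂ (λ x y → x + 2 + y) (∣m-n∣+2*[m⊓n]≡m+n c d) (boundary+2*inner (suc d) u positive) ⟩
    (c + d) + 2 + (suc d + 2 + 2 * sum u)
  ≡⟨ collect c d (sum u) ⟩
    suc c + 2 + 2 * (suc d + sum u) ∎
  where
  V = adjacentSum ∣_-_∣ (suc d ∷ u)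
  H = sum (map horizontalEdges (suc d ∷ u))
  I = adjacentSum innerPoints (suc d ∷ u)
  regroup : ∀ e V H m I → (e + V) + (2 + H) + 2 * (m + I) ≡ (e + 2 * m) + 2 + (V + H + 2 * I)
  regroup = solve-∀
  collect : ∀ c d S → (c + d) + 2 + (suc d + 2 + 2 * S) ≡ suc c + 2 + 2 * (suc d + S)
  collect = solve-∀

2*inn+perimeter≡2*[1+area] : ∀ c u → All (1 ≤_) (c ∷ u) →
  2 * inn (c ∷ u) + perimeter (c ∷ u) ≡ 2 * (1 + area (c ∷ u))
2*inn+perimeter≡2*[1+area] c u positive = begin
    2 * inn (c ∷ u) + perimeter (c ∷ u)
  ≡⟨ cong₂ (λ i p → 2 * i + p) (inn≡adjacentSum (c ∷ u)) (perimeter≡columnSums (c ∷ u)) ⟩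
    2 * I + ((c + V) + H)
  ≡⟨ regroup I c V H ⟩
    c + (V + H + 2 * I)
  ≡⟨ cong (c +_) (boundary+2*inner c u positive) ⟩
    c + (c + 2 + 2 * sum u)
  ≡⟨ collect c (sum u) ⟩
    2 * (1 + (c + sum u))
  ≡⟨ cong (λ x → 2 * (1 + x)) (sym (area≡sum (c ∷ u))) ⟩
    2 * (1 + area (c ∷ u)) ∎
  where
  V = adjacentSum ∣_-_∣ (c ∷ u)
  H = sum (map horizontalEdges (c ∷ u))
  I = adjacentSum innerPoints (c ∷ u)
  regroup : ∀ I c V H → 2 * I + ((c + V) + H) ≡ c + (V + H + 2 * I)
  regroup = solve-∀
  collect : ∀ c S → c + (c + 2 + 2 * S) ≡ 2 * (1 + (c + S))
  collect = solve-∀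

⌊2*m+n/2⌋≡m+⌊n/2⌋ : ∀ m n → ⌊ 2 * m + n /2⌋ ≡ m + ⌊ n /2⌋
⌊2*m+n/2⌋≡m+⌊n/2⌋ zero    n = refl
⌊2*m+n/2⌋≡m+⌊n/2⌋ (suc m) n = trans (cong ⌊_/2⌋ (shift m n)) (cong suc (⌊2*m+n/2⌋≡m+⌊n/2⌋ m n))
  where
  shift : ∀ m n → 2 * suc m + n ≡ suc (suc (2 * m + n))
  shift = solve-∀

1+area≡inn+sper : ∀ c u → All (1 ≤_) (c ∷ u) → 1 + area (c ∷ u) ≡ inn (c ∷ u) + sper (c ∷ u)
1+area≡inn+sper c u positive = begin
    X
  ≡⟨ sym (+-identityʳ X) ⟩
    X + ⌊ 0 /2⌋
  ≡⟨ sym (⌊2*m+n/2⌋≡m+⌊n/2⌋ X 0) ⟩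
    ⌊ 2 * X + 0 /2⌋
  ≡⟨ cong ⌊_/2⌋ (trans (+-identityʳ (2 * X)) (sym (2*inn+perimeter≡2*[1+area] c u positive))) ⟩
    ⌊ 2 * inn (c ∷ u) + perimeter (c ∷ u) /2⌋
  ≡⟨ ⌊2*m+n/2⌋≡m+⌊n/2⌋ (inn (c ∷ u)) (perimeter (c ∷ u)) ⟩
    inn (c ∷ u) + sper (c ∷ u) ∎
  where
  X = 1 + area (c ∷ u)

sum-allWords-suc : ∀ p n (f : List ℕ → ℕ) →
  sum (map f (allWords p (suc n))) ≡ sum (map (λ w → Σ< p (λ k → f (suc k ∷ w))) (allWords p n))
sum-allWords-suc p n f = trans (sum-map-concatMap f (λ w → map (_∷ w) (applyUpTo suc p)) (allWords p n))
  (cong sum (map-cong (λ w → trans (cong (λ ws → sum (map f ws)) (map-applyUpTo suc (_∷ w) p))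
                                   (sum-map-applyUpTo f (λ k → suc k ∷ w) p))
                      (allWords p n)))

isContinuation : ℕ → ℕ → List ℕ → Bool
isContinuation p c w = allIn p w ∧ chainOK p (c ∷ w)

continuations : ℕ → ℕ → ℕ → ℕ
continuations p n c = sum (map (λ w → ind (isContinuation p c w)) (allWords p n))

allIn-∷ : ∀ {p k} w → k < p → allIn p (suc k ∷ w) ≡ allIn p w
allIn-∷ {p} w k<p = cong (_∧ allIn p w) (Equivalence.to T-≡ (<⇒<ᵇ k<p))

isContinuation-∷ : ∀ {p k} c w → k < p →
  isContinuation p c (suc k ∷ w) ≡ stepOK p c (suc k) ∧ isContinuation p (suc k) w
isContinuation-∷ {p} {k} c w k<p =
  trans (cong (_∧ chainOK p (c ∷ suc k ∷ w)) (allIn-∷ w k<p))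
        (∧-leftComm (allIn p w) (stepOK p c (suc k)) (chainOK p (suc k ∷ w)))

isPFibWord-∷ : ∀ {p k} w → k < p → isPFibWord p (suc k ∷ w) ≡ (suc k ≡ᵇ p) ∧ isContinuation p (suc k) w
isPFibWord-∷ {p} {k} w k<p = cong (λ b → (suc k ≡ᵇ p) ∧ b ∧ chainOK p (suc k ∷ w)) (allIn-∷ w k<p)

continuations-suc : ∀ p n c → continuations p (suc n) c
  ≡ sum (map (λ w → Σ< p (λ k → ind (stepOK p c (suc k) ∧ isContinuation p (suc k) w))) (allWords p n))
continuations-suc p n c = trans (sum-allWords-suc p n (λ w → ind (isContinuation p c w)))
  (cong sum (map-cong (λ w → Σ<-cong p (λ k<p → cong ind (isContinuation-∷ c w k<p))) (allWords p n)))

continuations-1 : ∀ q n → continuations (suc q) (suc n) 1 ≡ continuations (suc q) n (suc q)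
continuations-1 q n = trans (continuations-suc (suc q) n 1)
  (cong sum (map-cong (λ w → Σ<-indicator (λ k → isContinuation (suc q) (suc k) w) ≤-refl) (allWords (suc q) n)))

continuations-≥2 : ∀ {q b} n → suc b ≤ q →
  continuations (suc q) (suc n) (suc (suc b))
    ≡ continuations (suc q) n (suc b) + continuations (suc q) n (suc q)
continuations-≥2 {q} {b} n b<q = begin
    continuations (suc q) (suc n) (suc (suc b))
  ≡⟨ continuations-suc (suc q) n (suc (suc b)) ⟩
    sum (map (λ w → Σ< (suc q) (λ k → ind (((k ≡ᵇ b) ∨ (k ≡ᵇ q)) ∧ Z w k))) (allWords (suc q) n))
  ≡⟨ cong sum (map-cong split (allWords (suc q) n)) ⟩
    sum (map (λ w → ind (Z w b) + ind (Z w q)) (allWords (suc q) n))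
  ≡⟨ sum-map-+ (λ w → ind (Z w b)) (λ w → ind (Z w q)) (allWords (suc q) n) ⟩
    continuations (suc q) n (suc b) + continuations (suc q) n (suc q) ∎
  where
  Z : List ℕ → ℕ → Bool
  Z w k = isContinuation (suc q) (suc k) w
  ≡ᵇ-disjoint : ∀ k {b q} → b < q → (k ≡ᵇ b) ∧ (k ≡ᵇ q) ≡ false
  ≡ᵇ-disjoint zero    {zero}  {suc q} _         = refl
  ≡ᵇ-disjoint zero    {suc b} {q}     _         = refl
  ≡ᵇ-disjoint (suc k) {zero}  {q}     _         = refl
  ≡ᵇ-disjoint (suc k) {suc b} {suc q} (s≤s b<q) = ≡ᵇ-disjoint k b<q
  ind-∨ : ∀ x y z → x ∧ y ≡ false → ind ((x ∨ y) ∧ z) ≡ ind (x ∧ z) + ind (y ∧ z)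
  ind-∨ true  false z _ = sym (+-identityʳ _)
  ind-∨ false y     z _ = refl
  split : ∀ w → Σ< (suc q) (λ k → ind (((k ≡ᵇ b) ∨ (k ≡ᵇ q)) ∧ Z w k)) ≡ ind (Z w b) + ind (Z w q)
  split w = begin
      Σ< (suc q) (λ k → ind (((k ≡ᵇ b) ∨ (k ≡ᵇ q)) ∧ Z w k))
    ≡⟨ Σ<-cong (suc q) (λ {k} _ → ind-∨ (k ≡ᵇ b) (k ≡ᵇ q) (Z w k) (≡ᵇ-disjoint k b<q)) ⟩
      Σ< (suc q) (λ k → ind ((k ≡ᵇ b) ∧ Z w k) + ind ((k ≡ᵇ q) ∧ Z w k))
    ≡⟨ Σ<-+ (suc q) (λ k → ind ((k ≡ᵇ b) ∧ Z w k)) (λ k → ind ((k ≡ᵇ q) ∧ Z w k)) ⟩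
      Σ< (suc q) (λ k → ind ((k ≡ᵇ b) ∧ Z w k)) + Σ< (suc q) (λ k → ind ((k ≡ᵇ q) ∧ Z w k))
    ≡⟨ cong₂ _+_ (Σ<-indicator (Z w) (m≤n⇒m≤1+n b<q)) (Σ<-indicator (Z w) ≤-refl) ⟩
      ind (Z w b) + ind (Z w q) ∎

length-window : ∀ q n → length (window (suc q) n) ≡ suc q
length-window q zero    = cong suc (length-replicate q)
length-window q (suc n) = cong suc (begin
    length (take q (window (suc q) n))
  ≡⟨ length-take q (window (suc q) n) ⟩
    q ⊓ length (window (suc q) n)
  ≡⟨ cong (q ⊓_) (length-window q n) ⟩
    q ⊓ suc q
  ≡⟨ m≤n⇒m⊓n≡m (n≤1+n q) ⟩
    q ∎)

sum-window : ∀ q n → sum (take (suc q) (window (suc q) n)) ≡ sum (window (suc q) n)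
sum-window q n = cong sum (take-all (suc q) (window (suc q) n) (≤-reflexive (length-window q n)))

sum-take-zeros : ∀ k m → sum (take k (replicate m 0)) ≡ 0
sum-take-zeros zero    m       = refl
sum-take-zeros (suc k) zero    = refl
sum-take-zeros (suc k) (suc m) = sum-take-zeros k m

continuations≡window : ∀ q n {c} → c ≤ q →
  continuations (suc q) n (suc c) ≡ sum (take (suc c) (window (suc q) n))
continuations≡window q zero    {c}     _   = cong suc (sym (sum-take-zeros c q))
continuations≡window q (suc n) {zero}  _   = begin
    continuations (suc q) (suc n) 1
  ≡⟨ continuations-1 q n ⟩
    continuations (suc q) n (suc q)
  ≡⟨ continuations≡window q n ≤-refl ⟩
    sum (take (suc q) W)
  ≡⟨ trans (sum-window q n) (sym (+-identityʳ _)) ⟩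
    sum W + 0 ∎
  where
  W = window (suc q) n
continuations≡window q (suc n) {suc b} b<q = begin
    continuations (suc q) (suc n) (suc (suc b))
  ≡⟨ continuations-≥2 n b<q ⟩
    continuations (suc q) n (suc b) + continuations (suc q) n (suc q)
  ≡⟨ cong₂ _+_ (continuations≡window q n (<⇒≤ b<q)) (continuations≡window q n ≤-refl) ⟩
    sum (take (suc b) W) + sum (take (suc q) W)
  ≡⟨ trans (cong (sum (take (suc b) W) +_) (sum-window q n)) (+-comm _ (sum W)) ⟩
    sum W + sum (take (suc b) W)
  ≡⟨ cong (λ ws → sum W + sum ws) (sym prefix) ⟩
    sum W + sum (take (suc b) (take q W)) ∎
  where
  W = window (suc q) n
  prefix : take (suc b) (take q W) ≡ take (suc b) W
  prefix = trans (take-take (suc b) q W) (cong (λ m → take m W) (m≤n⇒m⊓n≡m b<q))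

sumOverPFib-1≡F : ∀ q k → sumOverPFib (λ _ → 1) (suc q) (suc k) ≡ F (suc q) (suc (suc k))
sumOverPFib-1≡F q k = begin
    sumOverPFib (λ _ → 1) p (suc k)
  ≡⟨ sum-allWords-suc p k (λ w → if isPFibWord p w then 1 else 0) ⟩
    sum (map (λ w → Σ< p (λ j → if isPFibWord p (suc j ∷ w) then 1 else 0)) (allWords p k))
  ≡⟨ cong sum (map-cong (λ w → Σ<-cong p (λ j<p → trans (if-1-0 _) (cong ind (isPFibWord-∷ w j<p))))
                        (allWords p k)) ⟩
    sum (map (λ w → Σ< p (λ j → ind ((j ≡ᵇ q) ∧ isContinuation p (suc j) w))) (allWords p k))
  ≡⟨ cong sum (map-cong (λ w → Σ<-indicator (λ j → isContinuation p (suc j) w) ≤-refl) (allWords p k)) ⟩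
    continuations p k p
  ≡⟨ continuations≡window q k ≤-refl ⟩
    sum (take p (window p k))
  ≡⟨ sum-window q k ⟩
    F p (suc (suc k)) ∎
  where
  p = suc q
  if-1-0 : ∀ b → (if b then 1 else 0) ≡ ind b
  if-1-0 true  = refl
  if-1-0 false = refl

sumOverPFib-+ : ∀ (f g : List ℕ → ℕ) p n →
  sumOverPFib f p n + sumOverPFib g p n ≡ sumOverPFib (λ w → f w + g w) p n
sumOverPFib-+ f g p n = trans (sym (sum-map-+ (restrict f) (restrict g) (allWords p n)))
                              (cong sum (map-cong (λ w → if-+ (isPFibWord p w)) (allWords p n)))
  where
  restrict : (List ℕ → ℕ) → List ℕ → ℕ
  restrict h w = if isPFibWord p w then h w else 0
  if-+ : ∀ b {x y} → (if b then x else 0) + (if b then y else 0) ≡ (if b then x + y else 0)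
  if-+ true  = refl
  if-+ false = refl

sumOverPFib-cong : ∀ {f g : List ℕ → ℕ} p n → (∀ w → T (isPFibWord p w) → f w ≡ g w) →
  sumOverPFib f p n ≡ sumOverPFib g p n
sumOverPFib-cong {f} {g} p n f≡g = cong sum (map-cong pointwise (allWords p n))
  where
  pointwise : ∀ w → (if isPFibWord p w then f w else 0) ≡ (if isPFibWord p w then g w else 0)
  pointwise w with isPFibWord p w | f≡g w
  ... | true  | f≡g′ = f≡g′ _
  ... | false | _    = refl

T-∧⁻ : ∀ x {y} → T (x ∧ y) → T x × T y
T-∧⁻ x = Equivalence.to (T-∧ {x})

allIn⇒positive : ∀ p u → T (allIn p u) → All (1 ≤_) u
allIn⇒positive p []          _ = []
allIn⇒positive p (zero ∷ u)  ()
allIn⇒positive p (suc c ∷ u) t = s≤s z≤n ∷ allIn⇒positive p u (proj₂ (T-∧⁻ (c <ᵇ p) t))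

pFibWord⇒positive : ∀ p c u → T (isPFibWord p (c ∷ u)) → All (1 ≤_) (c ∷ u)
pFibWord⇒positive p c u t =
  allIn⇒positive p (c ∷ u) (proj₁ (T-∧⁻ (allIn p (c ∷ u)) (proj₂ (T-∧⁻ (c ≡ᵇ p) t))))

pFibWord-1+area≡inn+sper : ∀ p u → T (isPFibWord p u) → 1 + area u ≡ inn u + sper u
pFibWord-1+area≡inn+sper p (c ∷ u) t = 1+area≡inn+sper c u (pFibWord⇒positive p c u t)

mainTheorem5 : (p n : ℕ) → 1 ≤ p → 1 ≤ n →
    F p (n + 1) + a p n ≡ i p n + s p n
mainTheorem5 (suc q) (suc k) _ _ = begin
    F (suc q) (suc k + 1) + a (suc q) (suc k)
  ≡⟨ cong (λ m → F (suc q) m + a (suc q) (suc k)) (+-comm (suc k) 1) ⟩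
    F (suc q) (suc (suc k)) + a (suc q) (suc k)
  ≡⟨ cong (_+ a (suc q) (suc k)) (sym (sumOverPFib-1≡F q k)) ⟩
    sumOverPFib (λ _ → 1) (suc q) (suc k) + sumOverPFib area (suc q) (suc k)
  ≡⟨ sumOverPFib-+ (λ _ → 1) area (suc q) (suc k) ⟩
    sumOverPFib (λ w → 1 + area w) (suc q) (suc k)
  ≡⟨ sumOverPFib-cong (suc q) (suc k) (pFibWord-1+area≡inn+sper (suc q)) ⟩
    sumOverPFib (λ w → inn w + sper w) (suc q) (suc k)
  ≡⟨ sym (sumOverPFib-+ inn sper (suc q) (suc k)) ⟩
    i (suc q) (suc k) + s (suc q) (suc k) ∎
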